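{- Let $k, d, q \in \mathbb{N}$ satisfy $k,q \ge 2$ and $d \ge 4kq$. If $A \subseteq L(T_{k,d})$ is a $q$-subset, then there exists a set $F \subseteq V(T_{k,d})$ such that: (1) for each $v \in F$ and each $u \in \mathsf{Children}(v)$ it holds that $\mathsf{Frac}_A(u) \ge \frac 1 {4q}$; (2) $\sum_{v\in F} \mathsf{Leaves}(v) \ge d \cdot k^{d} \cdot (4q)^{ -3k \log k}$.
   Context: $\log$ denotes the base-2 logarithm. $T_{k,d}$ is the full $k$-ary rooted tree of depth $d$ (root of depth $0$, $k^d$ leaves at depth $d$). $L(T)$ is the set of leaves of a rooted tree $T$, $T^v_{k,d}$ is the subtree rooted at $v$, and $\mathsf{Children}(v)$ is the set of children of $v$. $\mathsf{Leaves}(v)=|L(T^v_{k,d})|$ (equal to $k^{d-h}$ for $v$ of depth $h$). For $A\subseteq L(T_{k,d})$, $\mathsf{Frac}_A(v)=|A\cap L(T^v_{k,d})|/\mathsf{Leaves}(v)$. A subset $A\subseteq L(T_{k,d})$ is a $q$-subset if $|A|\ge k^d/q$. -}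

module Defs where

open import Data.Nat using (ℕ; zero; suc; _+_; _*_; _∸_; _^_; _≤_; _<_; _<?_)
open import Data.Bool using (Bool; true; false; _∧_)
open import Data.Fin using (Fin)
open import Data.Fin.Properties using () renaming (_≟_ to _≟ᶠ_)
open import Data.List using (List; []; _∷_; map; concatMap; filter; length; allFin; _∷ʳ_)
open import Data.Nat.ListAction using (sum)
open import Data.Vec using (Vec; toList) renaming ([] to []ᵛ; _∷_ to _∷ᵛ_)
open import Relation.Nullary using (yes; no; does)

-- Vertices of T_{k,d}: words over Fin k (the path from the root) of length ≤ d;
-- the depth of a vertex is the length of its word; the root is [].
Vertex : ℕ → Set
Vertex k = List (Fin k)

Leaf : ℕ → ℕ → Set
Leaf k d = Vec (Fin k) d

allVecs : (k n : ℕ) → List (Vec (Fin k) n)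
allVecs k zero = []ᵛ ∷ []
allVecs k (suc n) = concatMap (λ i → map (i ∷ᵛ_) (allVecs k n)) (allFin k)

LeafSubset : ℕ → ℕ → Set
LeafSubset k d = Leaf k d → Bool

card : {k d : ℕ} → LeafSubset k d → ℕ
card {k} {d} A = length (filter (λ ℓ → A ℓ Data.Bool.≟ true) (allVecs k d))

-- A is a q-subset: |A| ≥ k^d / q, i.e. q * |A| ≥ k^d.
IsQSubset : {k d : ℕ} → ℕ → LeafSubset k d → Set
IsQSubset {k} {d} q A = k ^ d ≤ q * card A

isPrefix : {k : ℕ} → List (Fin k) → List (Fin k) → Bool
isPrefix [] _ = true
isPrefix (x ∷ xs) [] = false
isPrefix (x ∷ xs) (y ∷ ys) = does (x ≟ᶠ y) ∧ isPrefix xs ys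

Leaves : {k : ℕ} → ℕ → Vertex k → ℕ
Leaves {k} d v = k ^ (d ∸ length v)

countBelow : {k d : ℕ} → LeafSubset k d → Vertex k → ℕ
countBelow {k} {d} A v =
  length (filter (λ ℓ → (A ℓ ∧ isPrefix v (toList ℓ)) Data.Bool.≟ true) (allVecs k d))

-- Frac_A(v) ≥ 1/(4q), cross-multiplied: Leaves(v) ≤ 4q · |A ∩ L(T^v)|.
FracAtLeastInv4q : {k d : ℕ} → ℕ → LeafSubset k d → Vertex k → Set
FracAtLeastInv4q {k} {d} q A v = Leaves d v ≤ (4 * q) * countBelow A v

Children : {k : ℕ} → ℕ → Vertex k → List (Vertex k)
Children {k} d v with length v <? d
... | yes _ = map (v ∷ʳ_) (allFin k)
... | no _ = []

sumLeaves : {k : ℕ} → ℕ → List (Vertex k) → ℕ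
sumLeaves d F = sum (map (Leaves d) F)

-- S ≥ N · a^(-(3k·log₂ k)) for naturals S, N, a ≥ 2, k ≥ 2, with log₂ real.
-- Encoded exactly via rationals: for every rational p/m > 3k·log₂ k
-- (i.e. 2^p > k^(3km), m ≥ 1) we have a^(p/m) · S ≥ N, i.e. a^p · S^m ≥ N^m.
-- (By continuity of x ↦ a^x this is equivalent to a^(3k log₂ k) · S ≥ N.)
BoundWithLogExponent : (S N a k : ℕ) → Set
BoundWithLogExponent S N a k =
  (p m : ℕ) → 1 ≤ m → k ^ (3 * k * m) < 2 ^ p → N ^ m ≤ a ^ p * S ^ m

-- Call a vertex heavy if Frac_A ≥ 1/(2q) and good if all its children have Frac_A ≥ 1/(4q).
-- On every level the heavy vertices cover at least k^d/(2q) leaves, since the other vertices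
-- contain fewer than k^d/(2q) ≤ |A|/2 elements of A. From a vertex that is not good, step to its
-- heaviest child: some sibling holds little of A, so the density improves by the factor
-- (2k-1)/(2k-2). As a density never exceeds 1, greedy descent from a heavy vertex reaches a good
-- vertex within J = (2k-2)r steps once 2^r > 2q, losing at most a factor k^J in Leaves.
-- Descending from all heavy vertices on the levels 0, L, 2L, … (L = J+1) gives ⌊d/L⌋ ≥ d/(2L)
-- disjoint families, so d·k^d ≤ 4q·L·k^J·Σ_F Leaves, and 4q·L·k^J ≤ k^(3kr) ≤ (4q)^(3k log k)
-- when 2^r ≤ 4q < 2^(r+1).

module Submission where

open import Defs
open import Data.Bool using (Bool; true; false; _∧_; if_then_else_) renaming (_≟_ to _≟ᵇ_)
open import Data.Bool.Properties using (∧-identityʳ; ∧-zeroʳ)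
open import Data.Empty using (⊥-elim)
open import Data.Fin using (Fin; zero; suc)
open import Data.Fin.Properties using (¬∀⟶∃¬) renaming (_≟_ to _≟ᶠ_)
import Data.Fin.Properties as Fin
open import Data.List using (List; []; _∷_; _++_; _∷ʳ_; map; filter; concatMap; cartesianProductWith; allFin; length; take)
open import Data.List.Extrema.Nat using (argmax; f[xs]≤f[argmax])
open import Data.List.Membership.Propositional using (_∈_)
open import Data.List.Membership.Propositional.Properties using (∈-allFin)
open import Data.List.Properties using (map-++; map-cong; map-cong-local; map-∘; map-tabulate; length-tabulate; length-++; ++-assoc; ++-identityʳ; map-id-local; ∷-injective)
open import Data.List.Relation.Unary.All as All using (All; []; _∷_)
import Data.List.Relation.Unary.All.Properties as All
open import Data.List.Relation.Unary.Any using (here; there)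
open import Data.List.Relation.Unary.AllPairs using ([]; _∷_)
open import Data.List.Relation.Unary.Unique.Propositional using (Unique)
import Data.List.Relation.Unary.Unique.Propositional.Properties as Unique
open import Data.Nat using (ℕ; zero; suc; _+_; _*_; _∸_; _^_; _≤_; _<_; z≤n; s≤s; _≤?_; _<?_; NonZero)
open import Data.Nat.DivMod using (_/_; _%_; m/n*n≤m; m≥n⇒m/n>0; m≡m%n+[m/n]*n; m%n<n)
open import Data.Nat.ListAction using (sum)
open import Data.Nat.ListAction.Properties using (sum-++)
open import Data.Nat.Properties
open import Data.Nat.Solver using (module +-*-Solver)
open import Data.Product using (Σ; _×_; _,_; proj₁; proj₂)
open import Data.Vec using (Vec; toList) renaming (_∷_ to _∷ᵛ_)
open import Data.Vec.Properties using (length-toList)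
open import Function using (_∘_)
open import Relation.Binary.PropositionalEquality using (_≡_; _≢_; refl; sym; trans; cong; cong₂; subst; subst₂; setoid; module ≡-Reasoning)
open import Relation.Nullary using (Dec; yes; no; ¬_; does)
open import Relation.Nullary.Decidable using (dec-true; dec-false; decidable-stable)
open import Relation.Unary using (Decidable)

open +-*-Solver

sumOf : ∀ {a} {X : Set a} → (X → ℕ) → List X → ℕ
sumOf f xs = sum (map f xs)

module _ {a} {X : Set a} where

  sumOf-cong-local : {f g : X → ℕ} {xs : List X} → All (λ x → f x ≡ g x) xs → sumOf f xs ≡ sumOf g xs
  sumOf-cong-local eqs = cong sum (map-cong-local eqs)

  sumOf-cong : {f g : X → ℕ} → (∀ x → f x ≡ g x) → (xs : List X) → sumOf f xs ≡ sumOf g xs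
  sumOf-cong eq xs = cong sum (map-cong eq xs)

  sumOf-mono-local : {f g : X → ℕ} {xs : List X} → All (λ x → f x ≤ g x) xs → sumOf f xs ≤ sumOf g xs
  sumOf-mono-local [] = z≤n
  sumOf-mono-local (le ∷ les) = +-mono-≤ le (sumOf-mono-local les)

  sumOf-mono : {f g : X → ℕ} → (∀ x → f x ≤ g x) → (xs : List X) → sumOf f xs ≤ sumOf g xs
  sumOf-mono le xs = sumOf-mono-local {xs = xs} (All.tabulate (λ {x} _ → le x))

  sumOf-zero : {f : X → ℕ} → (∀ x → f x ≡ 0) → (xs : List X) → sumOf f xs ≡ 0
  sumOf-zero zeros [] = refl
  sumOf-zero zeros (x ∷ xs) = cong₂ _+_ (zeros x) (sumOf-zero zeros xs)

  sumOf-const : (c : ℕ) (xs : List X) → sumOf (λ _ → c) xs ≡ length xs * c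
  sumOf-const c [] = refl
  sumOf-const c (x ∷ xs) = cong (c +_) (sumOf-const c xs)

  sumOf-++ : (f : X → ℕ) (xs ys : List X) → sumOf f (xs ++ ys) ≡ sumOf f xs + sumOf f ys
  sumOf-++ f xs ys = trans (cong sum (map-++ f xs ys)) (sum-++ (map f xs) (map f ys))

  sumOf-+ : (f g : X → ℕ) (xs : List X) → sumOf (λ x → f x + g x) xs ≡ sumOf f xs + sumOf g xs
  sumOf-+ f g [] = refl
  sumOf-+ f g (x ∷ xs) = begin
    f x + g x + sumOf (λ x → f x + g x) xs  ≡⟨ cong (f x + g x +_) (sumOf-+ f g xs) ⟩
    f x + g x + (sumOf f xs + sumOf g xs)   ≡⟨ solve 4 (λ a b c d → a :+ b :+ (c :+ d) := a :+ c :+ (b :+ d)) refl (f x) (g x) _ _ ⟩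
    f x + sumOf f xs + (g x + sumOf g xs)   ∎
    where open ≡-Reasoning

  sumOf-*ˡ : (c : ℕ) (f : X → ℕ) (xs : List X) → sumOf (λ x → c * f x) xs ≡ c * sumOf f xs
  sumOf-*ˡ c f [] = sym (*-zeroʳ c)
  sumOf-*ˡ c f (x ∷ xs) = trans (cong (c * f x +_) (sumOf-*ˡ c f xs)) (sym (*-distribˡ-+ c (f x) _))

  sumOf-filter : (f : X → ℕ) {p : _} {P : X → Set p} (P? : Decidable P) (xs : List X) →
    sumOf f (filter P? xs) ≡ sumOf (λ x → if does (P? x) then f x else 0) xs
  sumOf-filter f P? [] = refl
  sumOf-filter f P? (x ∷ xs) with does (P? x)
  ... | true = cong (f x +_) (sumOf-filter f P? xs)
  ... | false = sumOf-filter f P? xs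

  sumOf-≤-replace : {f : X → ℕ} {M : ℕ} {x : X} {xs : List X} → x ∈ xs →
    All (λ y → f y ≤ M) xs → sumOf f xs + M ≤ length xs * M + f x
  sumOf-≤-replace {f} {M} {x} {y ∷ ys} (here refl) (_ ∷ bounds) = begin
    f x + sumOf f ys + M    ≡⟨ solve 3 (λ a b c → a :+ b :+ c := b :+ c :+ a) refl (f x) _ M ⟩
    sumOf f ys + M + f x    ≤⟨ +-monoˡ-≤ (f x) (+-monoˡ-≤ M (subst (sumOf f ys ≤_) (sumOf-const M ys) (sumOf-mono-local bounds))) ⟩
    length ys * M + M + f x ≡⟨ cong (_+ f x) (+-comm (length ys * M) M) ⟩
    M + length ys * M + f x ∎
    where open ≤-Reasoning
  sumOf-≤-replace {f} {M} {x} {y ∷ ys} (there x∈ys) (fy≤M ∷ bounds) = begin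
    f y + sumOf f ys + M        ≡⟨ +-assoc (f y) _ M ⟩
    f y + (sumOf f ys + M)      ≤⟨ +-mono-≤ fy≤M (sumOf-≤-replace x∈ys bounds) ⟩
    M + (length ys * M + f x)   ≡⟨ sym (+-assoc M _ _) ⟩
    M + length ys * M + f x     ∎
    where open ≤-Reasoning

sumOf-swap : ∀ {a b} {X : Set a} {Y : Set b} (f : X → Y → ℕ) (xs : List X) (ys : List Y) →
  sumOf (λ x → sumOf (f x) ys) xs ≡ sumOf (λ y → sumOf (λ x → f x y) xs) ys
sumOf-swap f [] ys = sym (sumOf-zero (λ _ → refl) ys)
sumOf-swap f (x ∷ xs) ys = trans (cong (sumOf (f x) ys +_) (sumOf-swap f xs ys))
                                 (sym (sumOf-+ (f x) (λ y → sumOf (λ x → f x y) xs) ys))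

sumOf-map : ∀ {a b} {X : Set a} {Y : Set b} (f : Y → ℕ) (g : X → Y) (xs : List X) →
  sumOf f (map g xs) ≡ sumOf (f ∘ g) xs
sumOf-map f g xs = cong sum (sym (map-∘ xs))

sumOf-concatMap : ∀ {a b} {X : Set a} {Y : Set b} (f : Y → ℕ) (g : X → List Y) (xs : List X) →
  sumOf f (concatMap g xs) ≡ sumOf (λ x → sumOf f (g x)) xs
sumOf-concatMap f g [] = refl
sumOf-concatMap f g (x ∷ xs) = trans (sumOf-++ f (g x) _) (cong (sumOf f (g x) +_) (sumOf-concatMap f g xs))

sumOf-cartesianProductWith : ∀ {a b c} {X : Set a} {Y : Set b} {Z : Set c}
  (f : Z → ℕ) (h : X → Y → Z) (xs : List X) (ys : List Y) →
  sumOf f (cartesianProductWith h xs ys) ≡ sumOf (λ x → sumOf (f ∘ h x) ys) xs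
sumOf-cartesianProductWith f h [] ys = refl
sumOf-cartesianProductWith f h (x ∷ xs) ys =
  trans (sumOf-++ f (map (h x) ys) _)
        (cong₂ _+_ (sumOf-map f (h x) ys) (sumOf-cartesianProductWith f h xs ys))

sumOf-allFin-suc : {n : ℕ} (f : Fin (suc n) → ℕ) → sumOf f (allFin (suc n)) ≡ f zero + sumOf (f ∘ suc) (allFin n)
sumOf-allFin-suc f = cong (λ xs → f zero + sum xs) (trans (map-tabulate suc f) (sym (map-tabulate (λ i → i) (f ∘ suc))))

sumOf-allFin-single : {n : ℕ} (f : Fin n → ℕ) (j : Fin n) → (∀ i → i ≢ j → f i ≡ 0) → sumOf f (allFin n) ≡ f j
sumOf-allFin-single {suc n} f zero zeros =
  trans (sumOf-allFin-suc f) (trans (cong (f zero +_) (sumOf-zero (λ i → zeros (suc i) (λ ())) (allFin n))) (+-identityʳ (f zero)))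
sumOf-allFin-single {suc n} f (suc j) zeros =
  trans (sumOf-allFin-suc f) (cong₂ _+_ (zeros zero (λ ()))
    (sumOf-allFin-single (f ∘ suc) j (λ i i≢j → zeros (suc i) (i≢j ∘ Fin.suc-injective))))

length-allFin : (n : ℕ) → length (allFin n) ≡ n
length-allFin n = length-tabulate (λ i → i)

^-distribʳ-* : ∀ m n o → (m * n) ^ o ≡ m ^ o * n ^ o
^-distribʳ-* m n zero = refl
^-distribʳ-* m n (suc o) = begin
  m * n * (m * n) ^ o       ≡⟨ cong (m * n *_) (^-distribʳ-* m n o) ⟩
  m * n * (m ^ o * n ^ o)   ≡⟨ solve 4 (λ m n a b → m :* n :* (a :* b) := m :* a :* (n :* b)) refl m n (m ^ o) (n ^ o) ⟩
  m * m ^ o * (n * n ^ o)   ∎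
  where open ≡-Reasoning

n<2^n : ∀ n → n < 2 ^ n
n<2^n zero = s≤s z≤n
n<2^n (suc n) = begin-strict
  suc n           ≤⟨ n<2^n n ⟩
  2 ^ n           <⟨ m<m+n (2 ^ n) (m^n>0 2 n) ⟩
  2 ^ n + 2 ^ n   ≡⟨ cong (2 ^ n +_) (sym (+-identityʳ (2 ^ n))) ⟩
  2 ^ suc n       ∎
  where open ≤-Reasoning

2*n≤2^n : ∀ n → 2 * n ≤ 2 ^ n
2*n≤2^n zero = z≤n
2*n≤2^n (suc n) = *-monoʳ-≤ 2 (n<2^n n)

⌊log₂⌋-bracket : ∀ n → 1 ≤ n → Σ ℕ (λ r → 2 ^ r ≤ n × n < 2 ^ suc r)
⌊log₂⌋-bracket n 1≤n = search n (n<2^n n)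
  where
  search : ∀ b → n < 2 ^ b → Σ ℕ (λ r → 2 ^ r ≤ n × n < 2 ^ suc r)
  search zero n<1 = ⊥-elim (<⇒≱ n<1 1≤n)
  search (suc b) n<2^[1+b] with n <? 2 ^ b
  ... | yes n<2^b = search b n<2^b
  ... | no n≮2^b = b , ≮⇒≥ n≮2^b , n<2^[1+b]

bernoulli : ∀ x n → x ^ n * (x + n) ≤ suc x ^ n * x
bernoulli x zero = ≤-reflexive (cong (_+ 0) (+-identityʳ x))
bernoulli x (suc n) = m+n≤o⇒m≤o _ (begin
  x * x ^ n * (x + suc n) + x ^ n * n
    ≡⟨ solve 3 (λ x a n → x :* a :* (x :+ (con 1 :+ n)) :+ a :* n := (con 1 :+ x) :* (a :* (x :+ n))) refl x (x ^ n) n ⟩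
  suc x * (x ^ n * (x + n))            ≤⟨ *-monoʳ-≤ (suc x) (bernoulli x n) ⟩
  suc x * (suc x ^ n * x)              ≡⟨ sym (*-assoc (suc x) (suc x ^ n) x) ⟩
  suc x * suc x ^ n * x                ∎)
  where open ≤-Reasoning

2*n^n≤[1+n]^n : ∀ n .{{_ : NonZero n}} → 2 * n ^ n ≤ suc n ^ n
2*n^n≤[1+n]^n n = *-cancelʳ-≤ (2 * n ^ n) (suc n ^ n) n
  (subst (_≤ suc n ^ n * n) (solve 2 (λ n a → a :* (n :+ n) := con 2 :* a :* n) refl n (n ^ n)) (bernoulli n n))

-- Since (1 + 1/n)^n ≥ 2, the ratio ((n+1)/n)^(n r) is at least 2^r.
2q*n^[nr]<[1+n]^[nr] : ∀ q n r .{{_ : NonZero n}} → 2 * q < 2 ^ r → 2 * q * n ^ (n * r) < suc n ^ (n * r)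
2q*n^[nr]<[1+n]^[nr] q n r 2q<2^r = begin-strict
  2 * q * n ^ (n * r)      <⟨ *-monoˡ-< (n ^ (n * r)) {{m^n≢0 n (n * r)}} 2q<2^r ⟩
  2 ^ r * n ^ (n * r)      ≡⟨ cong (2 ^ r *_) (sym (^-*-assoc n n r)) ⟩
  2 ^ r * (n ^ n) ^ r      ≡⟨ sym (^-distribʳ-* 2 (n ^ n) r) ⟩
  (2 * n ^ n) ^ r          ≤⟨ ^-monoˡ-≤ r (2*n^n≤[1+n]^n n) ⟩
  (suc n ^ n) ^ r          ≡⟨ ^-*-assoc (suc n) n r ⟩
  suc n ^ (n * r)          ∎
  where open ≤-Reasoning

m≤2[m/n*n] : ∀ m n .{{_ : NonZero n}} → n ≤ m → m ≤ 2 * (m / n * n)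
m≤2[m/n*n] m n n≤m = begin
  m                         ≡⟨ m≡m%n+[m/n]*n m n ⟩
  m % n + m / n * n         ≤⟨ +-monoˡ-≤ (m / n * n) (<⇒≤ (<-≤-trans (m%n<n m n) n≤m/n*n)) ⟩
  m / n * n + m / n * n     ≡⟨ cong (m / n * n +_) (sym (+-identityʳ (m / n * n))) ⟩
  2 * (m / n * n)           ∎
  where
  open ≤-Reasoning
  n≤m/n*n : n ≤ m / n * n
  n≤m/n*n = subst (_≤ m / n * n) (*-identityˡ n) (*-monoˡ-≤ n (m≥n⇒m/n>0 n≤m))

-- Read P = ρ^j, Q = σ^j for ρ = 2k-1, σ = 2k-2 (k = 1 + k₁); m, M, s are the masses of a vertex,
-- of its heaviest child and of a sparse child, ℓ the number of leaves below a child.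
density-step : ∀ k₁ q P Q m M s ℓ → Q ≤ P → P * (suc k₁ * ℓ) ≤ 2 * q * (Q * m) →
  m + M ≤ suc k₁ * M + s → 4 * q * s ≤ ℓ → suc (2 * k₁) * P * ℓ ≤ 2 * q * (2 * k₁ * Q * M)
density-step k₁ q P Q m M s ℓ Q≤P dense m+M≤ sparse = +-cancelʳ-≤ (P * ℓ) _ _ (begin
  suc (2 * k₁) * P * ℓ + P * ℓ
    ≡⟨ solve 3 (λ k P ℓ → (con 1 :+ con 2 :* k) :* P :* ℓ :+ P :* ℓ := con 2 :* (P :* ((con 1 :+ k) :* ℓ))) refl k₁ P ℓ ⟩
  2 * (P * (suc k₁ * ℓ))                          ≤⟨ *-monoʳ-≤ 2 dense ⟩
  2 * (2 * q * (Q * m))                           ≤⟨ *-monoʳ-≤ 2 (*-monoʳ-≤ (2 * q) (*-monoʳ-≤ Q m≤)) ⟩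
  2 * (2 * q * (Q * (k₁ * M + s)))
    ≡⟨ solve 5 (λ k q Q M s → con 2 :* (con 2 :* q :* (Q :* (k :* M :+ s)))
                             := con 2 :* q :* (con 2 :* k :* Q :* M) :+ Q :* (con 4 :* q :* s)) refl k₁ q Q M s ⟩
  2 * q * (2 * k₁ * Q * M) + Q * (4 * q * s)      ≤⟨ +-monoʳ-≤ (2 * q * (2 * k₁ * Q * M)) (*-mono-≤ Q≤P sparse) ⟩
  2 * q * (2 * k₁ * Q * M) + P * ℓ                ∎)
  where
  open ≤-Reasoning
  m≤ : m ≤ k₁ * M + s
  m≤ = +-cancelˡ-≤ M _ _ (subst₂ _≤_ (+-comm m M) (+-assoc M (k₁ * M) s) m+M≤)

boundWithLogExponent : ∀ {S N a k r C} → N ≤ C * S → C ≤ k ^ (3 * k * r) → 2 ^ r ≤ a →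
  BoundWithLogExponent S N a k
boundWithLogExponent {S} {N} {a} {k} {r} {C} N≤CS C≤ 2^r≤a p m _ k^[3km]<2^p = begin
  N ^ m                          ≤⟨ ^-monoˡ-≤ m N≤CS ⟩
  (C * S) ^ m                    ≡⟨ ^-distribʳ-* C S m ⟩
  C ^ m * S ^ m                  ≤⟨ *-monoˡ-≤ (S ^ m) (^-monoˡ-≤ m C≤) ⟩
  (k ^ (3 * k * r)) ^ m * S ^ m  ≡⟨ cong (_* S ^ m) (swap-exponents (3 * k) r m) ⟩
  (k ^ (3 * k * m)) ^ r * S ^ m  ≤⟨ *-monoˡ-≤ (S ^ m) (^-monoˡ-≤ r (<⇒≤ k^[3km]<2^p)) ⟩
  (2 ^ p) ^ r * S ^ m
    ≡⟨ cong (_* S ^ m) (trans (^-*-assoc 2 p r) (trans (cong (2 ^_) (*-comm p r)) (sym (^-*-assoc 2 r p)))) ⟩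
  (2 ^ r) ^ p * S ^ m            ≤⟨ *-monoˡ-≤ (S ^ m) (^-monoˡ-≤ p 2^r≤a) ⟩
  a ^ p * S ^ m                  ∎
  where
  open ≤-Reasoning
  swap-exponents : ∀ c x y → (k ^ (c * x)) ^ y ≡ (k ^ (c * y)) ^ x
  swap-exponents c x y = begin-equality
    (k ^ (c * x)) ^ y  ≡⟨ ^-*-assoc k (c * x) y ⟩
    k ^ (c * x * y)    ≡⟨ cong (k ^_) (solve 3 (λ c x y → c :* x :* y := c :* y :* x) refl c x y) ⟩
    k ^ (c * y * x)    ≡⟨ sym (^-*-assoc k (c * y) x) ⟩
    (k ^ (c * y)) ^ x  ∎

𝟙 : Bool → ℕ
𝟙 true = 1
𝟙 false = 0

𝟙-∧-≤ : ∀ b c → 𝟙 (b ∧ c) ≤ 𝟙 c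
𝟙-∧-≤ true c = ≤-refl
𝟙-∧-≤ false c = z≤n

length-filter-true : ∀ {a} {X : Set a} (b : X → Bool) (xs : List X) →
  length (filter (λ x → b x ≟ᵇ true) xs) ≡ sumOf (𝟙 ∘ b) xs
length-filter-true b [] = refl
length-filter-true b (x ∷ xs) with b x
... | true = cong suc (length-filter-true b xs)
... | false = length-filter-true b xs

length-∷ʳ : ∀ {a} {X : Set a} (xs : List X) (x : X) → length (xs ∷ʳ x) ≡ suc (length xs)
length-∷ʳ xs x = trans (length-++ xs) (+-comm (length xs) 1)

take-++ : ∀ {a} {X : Set a} (xs ys : List X) → take (length xs) (xs ++ ys) ≡ xs
take-++ [] ys = refl
take-++ (x ∷ xs) ys = cong (x ∷_) (take-++ xs ys)

sumOf-allVecs-suc : ∀ k n (f : Vec (Fin k) (suc n) → ℕ) →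
  sumOf f (allVecs k (suc n)) ≡ sumOf (λ i → sumOf (f ∘ (i ∷ᵛ_)) (allVecs k n)) (allFin k)
sumOf-allVecs-suc k n f =
  trans (sumOf-concatMap f _ (allFin k)) (sumOf-cong (λ i → sumOf-map f (i ∷ᵛ_) (allVecs k n)) (allFin k))

sumOf-isPrefix-allVecs : ∀ {k} n (v : List (Fin k)) → length v ≤ n →
  sumOf (λ ℓ → 𝟙 (isPrefix v (toList ℓ))) (allVecs k n) ≡ k ^ (n ∸ length v)
sumOf-isPrefix-allVecs zero [] _ = refl
sumOf-isPrefix-allVecs {k} (suc n) [] _ = begin
  sumOf (λ _ → 1) (allVecs k (suc n))                     ≡⟨ sumOf-allVecs-suc k n _ ⟩
  sumOf (λ _ → sumOf (λ _ → 1) (allVecs k n)) (allFin k)  ≡⟨ sumOf-cong (λ _ → sumOf-isPrefix-allVecs n [] z≤n) (allFin k) ⟩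
  sumOf (λ _ → k ^ n) (allFin k)                          ≡⟨ sumOf-const (k ^ n) (allFin k) ⟩
  length (allFin k) * k ^ n                               ≡⟨ cong (_* k ^ n) (length-allFin k) ⟩
  k ^ suc n                                               ∎
  where open ≡-Reasoning
sumOf-isPrefix-allVecs {k} (suc n) (x ∷ v) (s≤s |v|≤n) = begin
  sumOf (λ ℓ → 𝟙 (isPrefix (x ∷ v) (toList ℓ))) (allVecs k (suc n)) ≡⟨ sumOf-allVecs-suc k n _ ⟩
  sumOf (λ i → sumOf (extending i) (allVecs k n)) (allFin k)  ≡⟨ sumOf-allFin-single _ x only-x ⟩
  sumOf (extending x) (allVecs k n)
    ≡⟨ sumOf-cong (λ ℓ → cong (λ b → 𝟙 (b ∧ _)) (dec-true (x ≟ᶠ x) refl)) (allVecs k n) ⟩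
  sumOf (λ ℓ → 𝟙 (isPrefix v (toList ℓ))) (allVecs k n)       ≡⟨ sumOf-isPrefix-allVecs n v |v|≤n ⟩
  k ^ (n ∸ length v)                                          ∎
  where
  open ≡-Reasoning
  extending : Fin k → Vec (Fin k) n → ℕ
  extending i ℓ = 𝟙 (isPrefix (x ∷ v) (toList (i ∷ᵛ ℓ)))
  only-x : ∀ i → i ≢ x → sumOf (extending i) (allVecs k n) ≡ 0
  only-x i i≢x = sumOf-zero (λ ℓ → cong (λ b → 𝟙 (b ∧ _)) (dec-false (x ≟ᶠ i) (i≢x ∘ sym))) (allVecs k n)

isPrefix-∷ʳ : ∀ {k} (v w : List (Fin k)) → length v < length w →
  Σ (Fin k) λ j → isPrefix (v ∷ʳ j) w ≡ isPrefix v w × (∀ i → i ≢ j → isPrefix (v ∷ʳ i) w ≡ false)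
isPrefix-∷ʳ [] (y ∷ w) _ =
  y , cong (_∧ true) (dec-true (y ≟ᶠ y) refl) , λ i i≢y → cong (_∧ true) (dec-false (i ≟ᶠ y) i≢y)
isPrefix-∷ʳ (x ∷ v) (y ∷ w) (s≤s |v|<|w|) with isPrefix-∷ʳ v w |v|<|w|
... | j , v∷ʳj≼w , others =
  j , cong (does (x ≟ᶠ y) ∧_) v∷ʳj≼w , λ i i≢j → trans (cong (does (x ≟ᶠ y) ∧_) (others i i≢j)) (∧-zeroʳ _)

Children-< : ∀ {k} d (v : Vertex k) → length v < d → Children d v ≡ map (v ∷ʳ_) (allFin k)
Children-< d v |v|<d with length v <? d
... | yes _ = refl
... | no |v|≮d = ⊥-elim (|v|≮d |v|<d)

Children-≮ : ∀ {k} d (v : Vertex k) → ¬ length v < d → Children d v ≡ []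
Children-≮ d v |v|≮d with length v <? d
... | yes |v|<d = ⊥-elim (|v|≮d |v|<d)
... | no _ = refl

Leaves-∷ʳ : ∀ {k} d (v : Vertex k) (i : Fin k) → Leaves d (v ∷ʳ i) ≡ k ^ (d ∸ suc (length v))
Leaves-∷ʳ {k} d v i = cong (λ n → k ^ (d ∸ n)) (length-∷ʳ v i)

Leaves≡k*Leaves-∷ʳ : ∀ {k} d (v : Vertex k) (i : Fin k) → length v < d → Leaves d v ≡ k * Leaves d (v ∷ʳ i)
Leaves≡k*Leaves-∷ʳ {k} d v i |v|<d = trans (cong (k ^_) (+-∸-assoc 1 |v|<d)) (cong (k *_) (sym (Leaves-∷ʳ d v i)))

module _ {k d : ℕ} (A : LeafSubset k d) where

  countBelow≡sumOf : (v : Vertex k) → countBelow A v ≡ sumOf (λ ℓ → 𝟙 (A ℓ ∧ isPrefix v (toList ℓ))) (allVecs k d)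
  countBelow≡sumOf v = length-filter-true (λ ℓ → A ℓ ∧ isPrefix v (toList ℓ)) (allVecs k d)

  countBelow-root : countBelow A [] ≡ card A
  countBelow-root = trans (countBelow≡sumOf [])
    (trans (sumOf-cong (λ ℓ → cong 𝟙 (∧-identityʳ (A ℓ))) (allVecs k d)) (sym (length-filter-true A (allVecs k d))))

  countBelow≤Leaves : (v : Vertex k) → length v ≤ d → countBelow A v ≤ Leaves d v
  countBelow≤Leaves v |v|≤d = begin
    countBelow A v                                          ≡⟨ countBelow≡sumOf v ⟩
    sumOf (λ ℓ → 𝟙 (A ℓ ∧ isPrefix v (toList ℓ))) (allVecs k d)  ≤⟨ sumOf-mono (λ ℓ → 𝟙-∧-≤ (A ℓ) _) (allVecs k d) ⟩
    sumOf (λ ℓ → 𝟙 (isPrefix v (toList ℓ))) (allVecs k d)  ≡⟨ sumOf-isPrefix-allVecs d v |v|≤d ⟩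
    Leaves d v                                              ∎
    where open ≤-Reasoning

  sumOf-countBelow-∷ʳ : (v : Vertex k) → length v < d → sumOf (λ i → countBelow A (v ∷ʳ i)) (allFin k) ≡ countBelow A v
  sumOf-countBelow-∷ʳ v |v|<d = begin
    sumOf (λ i → countBelow A (v ∷ʳ i)) (allFin k)
      ≡⟨ sumOf-cong (λ i → countBelow≡sumOf (v ∷ʳ i)) (allFin k) ⟩
    sumOf (λ i → sumOf (λ ℓ → below i ℓ) (allVecs k d)) (allFin k)
      ≡⟨ sumOf-swap below (allFin k) (allVecs k d) ⟩
    sumOf (λ ℓ → sumOf (λ i → below i ℓ) (allFin k)) (allVecs k d)
      ≡⟨ sumOf-cong one-child (allVecs k d) ⟩
    sumOf (λ ℓ → 𝟙 (A ℓ ∧ isPrefix v (toList ℓ))) (allVecs k d)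
      ≡⟨ sym (countBelow≡sumOf v) ⟩
    countBelow A v ∎
    where
    open ≡-Reasoning
    below : Fin k → Leaf k d → ℕ
    below i ℓ = 𝟙 (A ℓ ∧ isPrefix (v ∷ʳ i) (toList ℓ))
    one-child : ∀ ℓ → sumOf (λ i → below i ℓ) (allFin k) ≡ 𝟙 (A ℓ ∧ isPrefix v (toList ℓ))
    one-child ℓ with isPrefix-∷ʳ v (toList ℓ) (subst (length v <_) (sym (length-toList ℓ)) |v|<d)
    ... | j , v∷ʳj≼ℓ , others = trans
      (sumOf-allFin-single (λ i → below i ℓ) j (λ i i≢j → cong 𝟙 (trans (cong (A ℓ ∧_) (others i i≢j)) (∧-zeroʳ (A ℓ)))))
      (cong (λ b → 𝟙 (A ℓ ∧ b)) v∷ʳj≼ℓ)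

level : (k : ℕ) → ℕ → List (Vertex k)
level k zero = [] ∷ []
level k (suc h) = cartesianProductWith _∷_ (allFin k) (level k h)

level-depth : ∀ k h → All (λ u → length u ≡ h) (level k h)
level-depth k zero = refl ∷ []
level-depth k (suc h) = All.cartesianProductWith⁺ (setoid (Fin k)) (setoid (Vertex k)) _∷_ (allFin k) (level k h)
  (λ _ u∈ → cong suc (All.lookup (level-depth k h) u∈))

level-unique : ∀ k h → Unique (level k h)
level-unique k zero = [] ∷ []
level-unique k (suc h) = Unique.cartesianProductWith⁺ _∷_ ∷-injective (Unique.allFin⁺ k) (level-unique k h)

sumOf-level-suc : ∀ k h (f : Vertex k → ℕ) →
  sumOf f (level k (suc h)) ≡ sumOf (λ i → sumOf (f ∘ (i ∷_)) (level k h)) (allFin k)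
sumOf-level-suc k h f = sumOf-cartesianProductWith f _∷_ (allFin k) (level k h)

sumOf-level-∷ʳ : ∀ k h (f : Vertex k → ℕ) →
  sumOf f (level k (suc h)) ≡ sumOf (λ u → sumOf (λ i → f (u ∷ʳ i)) (allFin k)) (level k h)
sumOf-level-∷ʳ k zero f =
  trans (sumOf-level-suc k zero f) (trans (sumOf-cong (λ i → +-identityʳ (f (i ∷ []))) (allFin k)) (sym (+-identityʳ _)))
sumOf-level-∷ʳ k (suc h) f = begin
  sumOf f (level k (suc (suc h)))
    ≡⟨ sumOf-level-suc k (suc h) f ⟩
  sumOf (λ j → sumOf (f ∘ (j ∷_)) (level k (suc h))) (allFin k)
    ≡⟨ sumOf-cong (λ j → sumOf-level-∷ʳ k h (f ∘ (j ∷_))) (allFin k) ⟩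
  sumOf (λ j → sumOf (λ u → sumOf (λ i → f (j ∷ u ∷ʳ i)) (allFin k)) (level k h)) (allFin k)
    ≡⟨ sym (sumOf-level-suc k h (λ u → sumOf (λ i → f (u ∷ʳ i)) (allFin k))) ⟩
  sumOf (λ u → sumOf (λ i → f (u ∷ʳ i)) (allFin k)) (level k (suc h)) ∎
  where open ≡-Reasoning

sumOf-level-const : ∀ k h c → sumOf (λ _ → c) (level k h) ≡ k ^ h * c
sumOf-level-const k zero c = refl
sumOf-level-const k (suc h) c = begin
  sumOf (λ _ → c) (level k (suc h))                        ≡⟨ sumOf-level-suc k h _ ⟩
  sumOf (λ _ → sumOf (λ _ → c) (level k h)) (allFin k)     ≡⟨ sumOf-cong (λ _ → sumOf-level-const k h c) (allFin k) ⟩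
  sumOf (λ _ → k ^ h * c) (allFin k)                       ≡⟨ sumOf-const (k ^ h * c) (allFin k) ⟩
  length (allFin k) * (k ^ h * c)                          ≡⟨ cong (_* (k ^ h * c)) (length-allFin k) ⟩
  k * (k ^ h * c)                                          ≡⟨ sym (*-assoc k (k ^ h) c) ⟩
  k ^ suc h * c                                            ∎
  where open ≡-Reasoning

sumOf-countBelow-level : ∀ {k d} (A : LeafSubset k d) h → h ≤ d → sumOf (countBelow A) (level k h) ≡ card A
sumOf-countBelow-level A zero _ = trans (+-identityʳ (countBelow A [])) (countBelow-root A)
sumOf-countBelow-level {k} {d} A (suc h) h<d = begin
  sumOf (countBelow A) (level k (suc h))                                ≡⟨ sumOf-level-∷ʳ k h (countBelow A) ⟩
  sumOf (λ u → sumOf (λ i → countBelow A (u ∷ʳ i)) (allFin k)) (level k h)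
    ≡⟨ sumOf-cong-local (All.map (λ {u} |u|≡h → sumOf-countBelow-∷ʳ A u (subst (_< d) (sym |u|≡h) h<d)) (level-depth k h)) ⟩
  sumOf (countBelow A) (level k h)                                      ≡⟨ sumOf-countBelow-level A h (<⇒≤ h<d) ⟩
  card A                                                                ∎
  where open ≡-Reasoning

sumLeaves-level : ∀ k d h → h ≤ d → sumLeaves d (level k h) ≡ k ^ d
sumLeaves-level k d h h≤d = begin
  sumOf (Leaves d) (level k h)         ≡⟨ sumOf-cong-local (All.map (cong (λ n → k ^ (d ∸ n))) (level-depth k h)) ⟩
  sumOf (λ _ → k ^ (d ∸ h)) (level k h) ≡⟨ sumOf-level-const k h (k ^ (d ∸ h)) ⟩
  k ^ h * k ^ (d ∸ h)                  ≡⟨ sym (^-distribˡ-+-* k h (d ∸ h)) ⟩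
  k ^ (h + (d ∸ h))                    ≡⟨ cong (k ^_) (m+[n∸m]≡n h≤d) ⟩
  k ^ d                                ∎
  where open ≡-Reasoning

module _ {k d : ℕ} (q : ℕ) (A : LeafSubset k d) where

  Heavy : Vertex k → Set
  Heavy u = Leaves d u ≤ 2 * q * countBelow A u

  heavy? : (u : Vertex k) → Dec (Heavy u)
  heavy? u = Leaves d u ≤? 2 * q * countBelow A u

  heavyLevel : ℕ → List (Vertex k)
  heavyLevel h = filter heavy? (level k h)

  heavyLeaves : Vertex k → ℕ
  heavyLeaves u = if does (heavy? u) then Leaves d u else 0

  2q*countBelow≤ : (u : Vertex k) → length u ≤ d → 2 * q * countBelow A u ≤ Leaves d u + 2 * q * heavyLeaves u
  2q*countBelow≤ u |u|≤d = split (heavy? u)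
    where
    split : (heavy : Dec (Heavy u)) → 2 * q * countBelow A u ≤ Leaves d u + 2 * q * (if does heavy then Leaves d u else 0)
    split (yes _) = ≤-trans (*-monoʳ-≤ (2 * q) (countBelow≤Leaves A u |u|≤d)) (m≤n+m _ _)
    split (no ¬heavy) = ≤-trans (<⇒≤ (≰⇒> ¬heavy)) (m≤m+n _ _)

  heavyLevel-mass : ∀ h → h ≤ d → IsQSubset q A → k ^ d ≤ 2 * q * sumLeaves d (heavyLevel h)
  heavyLevel-mass h h≤d q-subset = +-cancelˡ-≤ (k ^ d) _ _ (begin
    k ^ d + k ^ d                                      ≡⟨ cong (k ^ d +_) (sym (+-identityʳ (k ^ d))) ⟩
    2 * k ^ d                                          ≤⟨ *-monoʳ-≤ 2 q-subset ⟩
    2 * (q * card A)                                   ≡⟨ sym (*-assoc 2 q (card A)) ⟩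
    2 * q * card A                                     ≡⟨ cong (2 * q *_) (sym (sumOf-countBelow-level A h h≤d)) ⟩
    2 * q * sumOf (countBelow A) (level k h)           ≡⟨ sym (sumOf-*ˡ (2 * q) (countBelow A) (level k h)) ⟩
    sumOf (λ u → 2 * q * countBelow A u) (level k h)
      ≤⟨ sumOf-mono-local (All.map (λ {u} |u|≡h → 2q*countBelow≤ u (subst (_≤ d) (sym |u|≡h) h≤d)) (level-depth k h)) ⟩
    sumOf (λ u → Leaves d u + 2 * q * heavyLeaves u) (level k h)
      ≡⟨ sumOf-+ (Leaves d) (λ u → 2 * q * heavyLeaves u) (level k h) ⟩
    sumLeaves d (level k h) + sumOf (λ u → 2 * q * heavyLeaves u) (level k h)
      ≡⟨ cong₂ _+_ (sumLeaves-level k d h h≤d) (sumOf-*ˡ (2 * q) heavyLeaves (level k h)) ⟩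
    k ^ d + 2 * q * sumOf heavyLeaves (level k h)
      ≡⟨ cong (λ x → k ^ d + 2 * q * x) (sym (sumOf-filter (Leaves d) heavy? (level k h))) ⟩
    k ^ d + 2 * q * sumLeaves d (heavyLevel h)         ∎)
    where open ≤-Reasoning

module Descent {k₁ d : ℕ} (q : ℕ) (A : LeafSubset (suc k₁) d) where

  k : ℕ
  k = suc k₁

  σ ρ : ℕ
  σ = 2 * k₁
  ρ = suc σ

  Growth : ℕ → Set
  Growth J = 2 * q * σ ^ J < ρ ^ J

  Good : Vertex k → Set
  Good v = All (FracAtLeastInv4q q A) (Children d v)

  good? : (v : Vertex k) → Dec (Good v)
  good? v = All.all? (λ u → Leaves d u ≤? 4 * q * countBelow A u) (Children d v)

  ¬Good⇒depth< : (w : Vertex k) → ¬ Good w → length w < d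
  ¬Good⇒depth< w ¬good = decidable-stable (length w <? d)
    (λ |w|≮d → ¬good (subst (All _) (sym (Children-≮ d w |w|≮d)) []))

  ¬Good⇒sparseChild : (w : Vertex k) → ¬ Good w →
    Σ (Fin k) λ i → 4 * q * countBelow A (w ∷ʳ i) < Leaves d (w ∷ʳ i)
  ¬Good⇒sparseChild w ¬good with ¬∀⟶∃¬ k (λ i → FracAtLeastInv4q q A (w ∷ʳ i))
    (λ i → Leaves d (w ∷ʳ i) ≤? 4 * q * countBelow A (w ∷ʳ i))
    (λ all → ¬good (subst (All _) (sym (Children-< d w (¬Good⇒depth< w ¬good))) (All.map⁺ (All.tabulate⁺ all))))
  ... | i , ¬frac = i , ≰⇒> ¬frac

  -- Opaque so that unification never unfolds argmax and with it countBelow.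
  opaque
    heaviestChild : Vertex k → Fin k
    heaviestChild w = argmax (λ i → countBelow A (w ∷ʳ i)) zero (allFin k)

    heaviestChild-max : ∀ w → All (λ i → countBelow A (w ∷ʳ i) ≤ countBelow A (w ∷ʳ heaviestChild w)) (allFin k)
    heaviestChild-max w = f[xs]≤f[argmax] zero (allFin k)

  descend : ℕ → Vertex k → Vertex k
  descend zero w = w
  descend (suc n) w with good? w
  ... | yes _ = w
  ... | no _ = descend n (w ∷ʳ heaviestChild w)

  descend-extends : ∀ n w → Σ (List (Fin k)) λ s → descend n w ≡ w ++ s × length s ≤ n
  descend-extends zero w = [] , sym (++-identityʳ w) , z≤n
  descend-extends (suc n) w with good? w
  ... | yes _ = [] , sym (++-identityʳ w) , z≤n
  ... | no _ with descend-extends n (w ∷ʳ heaviestChild w)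
  ...   | s , eq , |s|≤n = heaviestChild w ∷ s , trans eq (++-assoc w _ s) , s≤s |s|≤n

  take-descend : ∀ n w → take (length w) (descend n w) ≡ w
  take-descend n w with descend-extends n w
  ... | s , eq , _ = trans (cong (take (length w)) eq) (take-++ w s)

  descend-depth≤ : ∀ n w → length w ≤ d → length (descend n w) ≤ d
  descend-depth≤ zero w |w|≤d = |w|≤d
  descend-depth≤ (suc n) w |w|≤d with good? w
  ... | yes _ = |w|≤d
  ... | no ¬good = descend-depth≤ n _ (subst (_≤ d) (sym (length-∷ʳ w _)) (¬Good⇒depth< w ¬good))

  Leaves≤k^n*Leaves-descend : ∀ n w → Leaves d w ≤ k ^ n * Leaves d (descend n w)
  Leaves≤k^n*Leaves-descend zero w = ≤-reflexive (sym (*-identityˡ _))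
  Leaves≤k^n*Leaves-descend (suc n) w with good? w
  ... | yes _ = m≤n*m (Leaves d w) (k ^ suc n) {{m^n≢0 k (suc n)}}
  ... | no ¬good = begin
    Leaves d w                        ≡⟨ Leaves≡k*Leaves-∷ʳ d w c (¬Good⇒depth< w ¬good) ⟩
    k * Leaves d (w ∷ʳ c)             ≤⟨ *-monoʳ-≤ k (Leaves≤k^n*Leaves-descend n (w ∷ʳ c)) ⟩
    k * (k ^ n * Leaves d (descend n (w ∷ʳ c)))  ≡⟨ sym (*-assoc k (k ^ n) _) ⟩
    k ^ suc n * Leaves d (descend n (w ∷ʳ c))    ∎
    where
    open ≤-Reasoning
    c = heaviestChild w

  -- The invariant of the descent: after j steps the density is at least (ρ/σ)^j/(2q).
  Dense : ℕ → Vertex k → Set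
  Dense j w = ρ ^ j * Leaves d w ≤ 2 * q * (σ ^ j * countBelow A w)

  heaviestChild-dense : ∀ j w → length w < d → Dense j w → (i : Fin k) →
    4 * q * countBelow A (w ∷ʳ i) < Leaves d (w ∷ʳ i) → Dense (suc j) (w ∷ʳ heaviestChild w)
  heaviestChild-dense j w |w|<d dense i sparse =
    density-step k₁ q (ρ ^ j) (σ ^ j) (countBelow A w) M (countBelow A (w ∷ʳ i)) (Leaves d (w ∷ʳ c))
      (^-monoˡ-≤ j (n≤1+n σ))
      (subst (λ x → ρ ^ j * x ≤ 2 * q * (σ ^ j * countBelow A w)) (Leaves≡k*Leaves-∷ʳ d w c |w|<d) dense)
      (subst (λ x → x + M ≤ k * M + countBelow A (w ∷ʳ i)) (sumOf-countBelow-∷ʳ A w |w|<d) replace)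
      (subst (4 * q * countBelow A (w ∷ʳ i) ≤_) (trans (Leaves-∷ʳ d w i) (sym (Leaves-∷ʳ d w c))) (<⇒≤ sparse))
    where
    c = heaviestChild w
    M = countBelow A (w ∷ʳ c)
    replace : sumOf (λ i → countBelow A (w ∷ʳ i)) (allFin k) + M ≤ k * M + countBelow A (w ∷ʳ i)
    replace = subst (λ n → sumOf (λ i → countBelow A (w ∷ʳ i)) (allFin k) + M ≤ n * M + countBelow A (w ∷ʳ i)) (length-allFin k)
      (sumOf-≤-replace (∈-allFin i) (heaviestChild-max w))

  ¬Dense : ∀ J → Growth J → ∀ w → length w ≤ d → ¬ Dense J w
  ¬Dense J growth w |w|≤d dense =
    <⇒≱ growth (*-cancelʳ-≤ (ρ ^ J) (2 * q * σ ^ J) (Leaves d w) {{m^n≢0 k (d ∸ length w)}} (begin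
      ρ ^ J * Leaves d w                ≤⟨ dense ⟩
      2 * q * (σ ^ J * countBelow A w)  ≤⟨ *-monoʳ-≤ (2 * q) (*-monoʳ-≤ (σ ^ J) (countBelow≤Leaves A w |w|≤d)) ⟩
      2 * q * (σ ^ J * Leaves d w)      ≡⟨ sym (*-assoc (2 * q) (σ ^ J) (Leaves d w)) ⟩
      2 * q * σ ^ J * Leaves d w        ∎))
    where open ≤-Reasoning

  descend-good : ∀ J → Growth J → ∀ n j w → j + n ≡ J → length w ≤ d → Dense j w → Good (descend n w)
  descend-good J growth zero j w j+0≡J |w|≤d dense =
    ⊥-elim (¬Dense J growth w |w|≤d (subst (λ x → Dense x w) (trans (sym (+-identityʳ j)) j+0≡J) dense))
  descend-good J growth (suc n) j w j+n≡J |w|≤d dense with good? w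
  ... | yes good = good
  ... | no ¬good with ¬Good⇒sparseChild w ¬good
  ...   | i , sparse = descend-good J growth n (suc j) (w ∷ʳ heaviestChild w) (trans (sym (+-suc j n)) j+n≡J)
            (subst (_≤ d) (sym (length-∷ʳ w _)) (¬Good⇒depth< w ¬good))
            (heaviestChild-dense j w (¬Good⇒depth< w ¬good) dense i sparse)

  Heavy⇒descend-good : ∀ J → Growth J → ∀ u → length u ≤ d → Heavy q A u → Good (descend J u)
  Heavy⇒descend-good J growth u |u|≤d heavy =
    descend-good J growth J 0 u refl |u|≤d (subst₂ (λ x y → x ≤ 2 * q * y) (sym (*-identityˡ _)) (sym (*-identityˡ _)) heavy)

  module Blocks (J : ℕ) (growth : Growth J) (q-subset : IsQSubset q A) where

    L : ℕ
    L = suc J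

    block : ℕ → List (Vertex k)
    block i = map (descend J) (heavyLevel q A (i * L))

    heavyLevel-members : ∀ h → All (λ u → Heavy q A u × length u ≡ h) (heavyLevel q A h)
    heavyLevel-members h = All.zip (All.all-filter (heavy? q A) (level k h) , All.filter⁺ (heavy? q A) (level-depth k h))

    block-depth≤ : ∀ i → i * L ≤ d → All (λ v → length v ≤ d) (block i)
    block-depth≤ i iL≤d = All.map⁺ (All.map (λ (_ , |u|≡iL) → descend-depth≤ J _ (subst (_≤ d) (sym |u|≡iL) iL≤d))
      (heavyLevel-members (i * L)))

    block-good : ∀ i → i * L ≤ d → All Good (block i)
    block-good i iL≤d = All.map⁺ (All.map (λ (heavy , |u|≡iL) → Heavy⇒descend-good J growth _ (subst (_≤ d) (sym |u|≡iL) iL≤d) heavy)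
      (heavyLevel-members (i * L)))

    block-depth∈ : ∀ i → All (λ v → i * L ≤ length v × length v < suc i * L) (block i)
    block-depth∈ i = All.map⁺ (All.map (λ {u} (_ , |u|≡iL) → bounds u |u|≡iL) (heavyLevel-members (i * L)))
      where
      bounds : ∀ u → length u ≡ i * L → i * L ≤ length (descend J u) × length (descend J u) < suc i * L
      bounds u |u|≡iL with descend-extends J u
      ... | s , eq , |s|≤J rewrite eq | length-++ u {s} | |u|≡iL =
        m≤m+n (i * L) (length s) , subst (i * L + length s <_) (+-comm (i * L) L) (+-monoʳ-< (i * L) (s≤s |s|≤J))

    block-unique : ∀ i → Unique (block i)
    block-unique i = Unique.map⁻ {f = take (i * L)}
      (subst Unique (sym truncate) (Unique.filter⁺ (heavy? q A) (level-unique k (i * L))))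
      where
      truncate : map (take (i * L)) (block i) ≡ heavyLevel q A (i * L)
      truncate = trans (sym (map-∘ (heavyLevel q A (i * L)))) (map-id-local (All.map
        (λ {u} (_ , |u|≡iL) → subst (λ n → take n (descend J u) ≡ u) |u|≡iL (take-descend J u)) (heavyLevel-members (i * L))))

    block-mass : ∀ i → i * L ≤ d → k ^ d ≤ 2 * q * (k ^ J * sumLeaves d (block i))
    block-mass i iL≤d = ≤-trans (heavyLevel-mass q A (i * L) iL≤d q-subset) (*-monoʳ-≤ (2 * q) (begin
      sumLeaves d (heavyLevel q A (i * L))
        ≤⟨ sumOf-mono (Leaves≤k^n*Leaves-descend J) (heavyLevel q A (i * L)) ⟩
      sumOf (λ u → k ^ J * Leaves d (descend J u)) (heavyLevel q A (i * L))
        ≡⟨ sumOf-*ˡ (k ^ J) (Leaves d ∘ descend J) (heavyLevel q A (i * L)) ⟩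
      k ^ J * sumOf (Leaves d ∘ descend J) (heavyLevel q A (i * L))
        ≡⟨ cong (k ^ J *_) (sym (sumOf-map (Leaves d) (descend J) (heavyLevel q A (i * L)))) ⟩
      k ^ J * sumLeaves d (block i)  ∎))
      where open ≤-Reasoning

    blocks : ℕ → List (Vertex k)
    blocks zero = []
    blocks (suc i) = block i ++ blocks i

    private
      earlier : ∀ i → suc i * L ≤ d → i * L ≤ d
      earlier i le = ≤-trans (m≤n+m (i * L) L) le

    blocks-depth≤ : ∀ n → n * L ≤ d → All (λ v → length v ≤ d) (blocks n)
    blocks-depth≤ zero _ = []
    blocks-depth≤ (suc i) le = All.++⁺ (block-depth≤ i (earlier i le)) (blocks-depth≤ i (earlier i le))

    blocks-good : ∀ n → n * L ≤ d → All Good (blocks n)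
    blocks-good zero _ = []
    blocks-good (suc i) le = All.++⁺ (block-good i (earlier i le)) (blocks-good i (earlier i le))

    blocks-depth< : ∀ n → All (λ v → length v < n * L) (blocks n)
    blocks-depth< zero = []
    blocks-depth< (suc i) = All.++⁺ (All.map proj₂ (block-depth∈ i))
      (All.map (λ |v|<iL → <-≤-trans |v|<iL (m≤n+m (i * L) L)) (blocks-depth< i))

    -- The blocks are disjoint because they live on disjoint ranges of depths.
    blocks-unique : ∀ n → Unique (blocks n)
    blocks-unique zero = []
    blocks-unique (suc i) = Unique.++⁺ (block-unique i) (blocks-unique i)
      (λ (v∈block , v∈blocks) → <⇒≱ (All.lookup (blocks-depth< i) v∈blocks) (proj₁ (All.lookup (block-depth∈ i) v∈block)))

    blocks-mass : ∀ n → n * L ≤ d → n * k ^ d ≤ 2 * q * (k ^ J * sumLeaves d (blocks n))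
    blocks-mass zero _ = z≤n
    blocks-mass (suc i) le = begin
      k ^ d + i * k ^ d
        ≤⟨ +-mono-≤ (block-mass i (earlier i le)) (blocks-mass i (earlier i le)) ⟩
      2 * q * (k ^ J * sumLeaves d (block i)) + 2 * q * (k ^ J * sumLeaves d (blocks i))
        ≡⟨ solve 4 (λ c x a b → c :* (x :* a) :+ c :* (x :* b) := c :* (x :* (a :+ b))) refl (2 * q) (k ^ J) _ _ ⟩
      2 * q * (k ^ J * (sumLeaves d (block i) + sumLeaves d (blocks i)))
        ≡⟨ cong (λ x → 2 * q * (k ^ J * x)) (sym (sumOf-++ (Leaves d) (block i) (blocks i))) ⟩
      2 * q * (k ^ J * sumLeaves d (blocks (suc i)))  ∎
      where open ≤-Reasoning

  goodFamily : ∀ J → Growth J → suc J ≤ d → IsQSubset q A →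
    Σ (List (Vertex k)) λ F → All (λ v → length v ≤ d) F × Unique F × All Good F ×
      d * k ^ d ≤ 4 * q * suc J * k ^ J * sumLeaves d F
  goodFamily J growth L≤d q-subset =
    blocks B , blocks-depth≤ B BL≤d , blocks-unique B , blocks-good B BL≤d , mass
    where
    open Blocks J growth q-subset
    B : ℕ
    B = d / L
    BL≤d : B * L ≤ d
    BL≤d = m/n*n≤m d L
    mass : d * k ^ d ≤ 4 * q * L * k ^ J * sumLeaves d (blocks B)
    mass = begin
      d * k ^ d                                ≤⟨ *-monoˡ-≤ (k ^ d) (m≤2[m/n*n] d L L≤d) ⟩
      2 * (B * L) * k ^ d
        ≡⟨ solve 3 (λ b l x → con 2 :* (b :* l) :* x := con 2 :* l :* (b :* x)) refl B L (k ^ d) ⟩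
      2 * L * (B * k ^ d)                      ≤⟨ *-monoʳ-≤ (2 * L) (blocks-mass B BL≤d) ⟩
      2 * L * (2 * q * (k ^ J * S))
        ≡⟨ solve 4 (λ l q y s → con 2 :* l :* (con 2 :* q :* (y :* s)) := con 4 :* q :* l :* y :* s) refl L q (k ^ J) S ⟩
      4 * q * L * k ^ J * S                    ∎
      where
      open ≤-Reasoning
      S = sumLeaves d (blocks B)

1+2k₁r≤2kr : ∀ k₁ r → 1 ≤ r → suc (2 * k₁ * r) ≤ 2 * (suc k₁ * r)
1+2k₁r≤2kr k₁ (suc r') _ = m+n≤o⇒m≤o _ (≤-reflexive
  (solve 2 (λ k r → con 1 :+ con 2 :* k :* (con 1 :+ r) :+ (con 1 :+ con 2 :* r)
                   := con 2 :* ((con 1 :+ k) :* (con 1 :+ r))) refl k₁ r'))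

1+2k₁r≤4kq : ∀ k₁ q r → 1 ≤ r → 2 ^ r ≤ 4 * q → suc (2 * k₁ * r) ≤ 4 * suc k₁ * q
1+2k₁r≤4kq k₁ q r 1≤r 2^r≤4q = begin
  suc (2 * k₁ * r)  ≤⟨ 1+2k₁r≤2kr k₁ r 1≤r ⟩
  2 * (k * r)       ≡⟨ solve 2 (λ k r → con 2 :* (k :* r) := k :* (con 2 :* r)) refl k r ⟩
  k * (2 * r)       ≤⟨ *-monoʳ-≤ k (≤-trans (2*n≤2^n r) 2^r≤4q) ⟩
  k * (4 * q)       ≡⟨ solve 2 (λ k q → k :* (con 4 :* q) := con 4 :* k :* q) refl k q ⟩
  4 * k * q         ∎
  where
  open ≤-Reasoning
  k = suc k₁

4q[1+J]k^J≤k^[3kr] : ∀ k₁ q r → 1 ≤ k₁ → 1 ≤ r → 4 * q < 2 ^ suc r →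
  4 * q * suc (2 * k₁ * r) * suc k₁ ^ (2 * k₁ * r) ≤ suc k₁ ^ (3 * suc k₁ * r)
4q[1+J]k^J≤k^[3kr] k₁@(suc k') q r@(suc r') _ 1≤r 4q<2^[1+r] = begin
  4 * q * suc J * k ^ J          ≤⟨ *-monoˡ-≤ (k ^ J) (*-mono-≤ 4q≤k^[1+r] 1+J≤k^[kr]) ⟩
  k ^ suc r * k ^ (k * r) * k ^ J ≡⟨ cong (_* k ^ J) (sym (^-distribˡ-+-* k (suc r) (k * r))) ⟩
  k ^ (suc r + k * r) * k ^ J     ≡⟨ sym (^-distribˡ-+-* k (suc r + k * r) J) ⟩
  k ^ (suc r + k * r + J)         ≤⟨ ^-monoʳ-≤ k exponent ⟩
  k ^ (3 * k * r)                 ∎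
  where
  open ≤-Reasoning
  k J : ℕ
  k = suc k₁
  J = 2 * k₁ * r
  2≤k : 2 ≤ k
  2≤k = s≤s (s≤s z≤n)
  4q≤k^[1+r] : 4 * q ≤ k ^ suc r
  4q≤k^[1+r] = ≤-trans (<⇒≤ 4q<2^[1+r]) (^-monoˡ-≤ (suc r) 2≤k)
  1+J≤k^[kr] : suc J ≤ k ^ (k * r)
  1+J≤k^[kr] = ≤-trans (1+2k₁r≤2kr k₁ r 1≤r) (≤-trans (2*n≤2^n (k * r)) (^-monoˡ-≤ (k * r) 2≤k))
  exponent : suc r + k * r + J ≤ 3 * k * r
  exponent = m+n≤o⇒m≤o _ (≤-reflexive (solve 2 (λ k r →
    (con 1 :+ (con 1 :+ r)) :+ (con 2 :+ k) :* (con 1 :+ r) :+ con 2 :* (con 1 :+ k) :* (con 1 :+ r) :+ r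
      := con 3 :* (con 2 :+ k) :* (con 1 :+ r)) refl k' r'))

lemma15 : (k d q : ℕ) → 2 ≤ k → 2 ≤ q → 4 * k * q ≤ d →
    (A : LeafSubset k d) → IsQSubset q A →
    Σ (List (Vertex k)) (λ F →
      All (λ v → length v ≤ d) F × Unique F ×
      ((v : Vertex k) → v ∈ F → (u : Vertex k) → u ∈ Children d v → FracAtLeastInv4q q A u) ×
      BoundWithLogExponent (sumLeaves d F) (d * k ^ d) (4 * q) k)
lemma15 zero d q () _ _ _ _
lemma15 (suc zero) d q (s≤s ()) _ _ _ _
lemma15 (suc (suc k')) d q _ 2≤q 4kq≤d A q-subset with ⌊log₂⌋-bracket (4 * q) (≤-trans (s≤s z≤n) (≤-trans 2≤q (m≤m+n q _)))
... | zero , _ , 4q<2 = ⊥-elim (<⇒≱ 4q<2 (≤-trans 2≤q (m≤m+n q _)))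
... | r@(suc _) , 2^r≤4q , 4q<2^[1+r] =
  let F , depths , unique , good , mass = goodFamily J growth 1+J≤d q-subset
  in F , depths , unique , (λ v v∈F u u∈children → All.lookup (All.lookup good v∈F) u∈children) ,
     boundWithLogExponent {k = k} {r = r} mass (4q[1+J]k^J≤k^[3kr] (suc k') q r (s≤s z≤n) (s≤s z≤n) 4q<2^[1+r]) 2^r≤4q
  where
  open Descent q A
  J : ℕ
  J = σ * r
  growth : Growth J
  growth = 2q*n^[nr]<[1+n]^[nr] q σ r (*-cancelˡ-< 2 (2 * q) (2 ^ r) (subst (_< 2 ^ suc r) (*-assoc 2 2 q) 4q<2^[1+r]))
  1+J≤d : suc J ≤ d
  1+J≤d = ≤-trans (1+2k₁r≤4kq (suc k') q r (s≤s z≤n) 2^r≤4q) 4kq≤d
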